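{- If the wild numbers conjecture is true (i.e. the wild integer semigroup $\mathcal{W}(\mathbb{Z})$ consists of all positive integers not divisible by $3$, equivalently the wild numbers are exactly the primes other than $3$), then the weak $3x+1$ conjecture holds, i.e. the semigroup $\mathcal{W}^{ -1}$ contains every positive integer.
   Context: For integers $n\ge 0$ let $g(n)=\frac{3n+2}{2n+1}$. The wild semigroup $\mathcal{W}$ is the multiplicative semigroup of positive rationals generated by $\{g(n): n\ge 0\}$ together with $\frac12$ (all finite products, repetitions allowed). The wild integer semigroup is $\mathcal{W}(\mathbb{Z})=\mathcal{W}\cap\mathbb{Z}$; the wild numbers are its irreducible elements (elements not expressible as a product of two nonunits of $\mathcal{W}(\mathbb{Z})$). $\mathcal{W}^{ -1}=\{w^{ -1}: w\in\mathcal{W}\}$ is the semigroup generated by $\{\frac{2n+1}{3n+2}: n\ge 0\}$ together with $2$. -}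

module Defs where

open import Data.Nat using (ℕ; suc; _+_; _*_; _≤_)
open import Data.Nat.Divisibility using (_∣_)
open import Data.Integer using (+_)
open import Data.Rational using (ℚ; _/_) renaming (_*_ to _*ℚ_)
open import Data.Product using (_×_)
open import Relation.Nullary using (¬_)
open import Function.Bundles using (_⇔_)

g : ℕ → ℚ
g n = + (3 * n + 2) / suc (2 * n)

ginv : ℕ → ℚ
ginv n = + (2 * n + 1) / suc (3 * n + 1)

data W : ℚ → Set where
  W-gen  : ∀ n → W (g n)
  W-half : W (+ 1 / 2)
  W-mul  : ∀ {p q} → W p → W q → W (p *ℚ q)

data Winv : ℚ → Set where
  Winv-gen : ∀ n → Winv (ginv n)
  Winv-two : Winv (+ 2 / 1)
  Winv-mul : ∀ {p q} → Winv p → Winv q → Winv (p *ℚ q)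

ℕ→ℚ : ℕ → ℚ
ℕ→ℚ n = + n / 1

-- Wild numbers conjecture: W(ℤ) = positive integers not divisible by 3.
-- (Every element of W is a positive rational, so W ∩ ℤ = W ∩ ℕ.)
WildNumbersConjecture : Set
WildNumbersConjecture = ∀ (n : ℕ) → (W (ℕ→ℚ n) ⇔ (1 ≤ n × ¬ (3 ∣ n)))

Weak3x+1Conjecture : Set
Weak3x+1Conjecture = ∀ (n : ℕ) → 1 ≤ n → Winv (ℕ→ℚ n)

{-# OPTIONS --safe #-}

-- Under the wild numbers conjecture every n with 3 ∤ n lies in W, and the inverse of an element
-- of W lies in W⁻¹, so natural numbers in W⁻¹ are closed under products and under cancelling
-- factors prime to 3. Since ginv n · (3n + 2) = 2n + 1, y ∈ W⁻¹ and 3x + 1 = 2y give x ∈ W⁻¹;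
-- in particular so do u ∈ W⁻¹ and 3x + 1 = 4u². Now argue by strong induction on N: even N and
-- multiples of 3 split off a factor 2 or 3 (and 8 ↦ 5 ↦ 3), while for N prime to 6 one picks u,
-- a product of numbers below N, with 4u² − 1 = 3N·s and 3 ∤ s, and cancels s. For N ≢ 7, 11
-- (mod 18) the one of (N ± 1)/2 that is prime to 3 will do; the two remaining classes need
-- products of degree 3 and 4 in N.

module Submission where

open import Defs
open import Data.Nat using (ℕ; zero; suc; _+_; _*_; _≤_; _<_; _≤ᵇ_; _<ᵇ_; z≤n; s≤s; NonZero; >-nonZero⁻¹)
open import Data.Nat.Properties
  using (≤-refl; ≤-trans; m≤m+n; n≤1+n; <ᵇ⇒<; ≤ᵇ⇒≤; +-mono-<-≤; *-monoˡ-≤; m<m*n; *-assoc; *-distribˡ-+; *-cancelˡ-≡)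
open import Data.Nat.Divisibility using (_∣_; >⇒∤; _∣0; ∣m+n∣m⇒∣n; m∣m*n; n∣m*n; ∣n⇒∣m*n)
open import Data.Nat.DivMod using (_divMod_; result)
open import Data.Nat.Induction using (<-rec)
open import Data.Nat.Primality using (prime?; euclidsLemma)
open import Data.Nat.Tactic.RingSolver using (solve; solve-∀)
open import Data.Fin using (Fin; toℕ)
open import Data.Fin.Patterns
open import Data.Integer as ℤ using (+_)
import Data.Integer.Properties as ℤP
open import Data.Rational using (1ℚ; toℚᵘ; fromℚᵘ) renaming (_*_ to _*ℚ_; _/_ to _/ℚ_)
import Data.Rational.Properties as ℚP
open import Data.Rational.Unnormalised as ℚᵘ using (mkℚᵘ; *≡*)
import Data.Rational.Unnormalised.Properties as ℚᵘP
open import Algebra.Bundles using (CommutativeMonoid)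
open import Algebra.Properties.CommutativeSemigroup (CommutativeMonoid.commutativeSemigroup ℚP.*-1-commutativeMonoid)
  using (interchange)
open import Data.Bool using (T)
open import Data.List using (_∷_; [])
open import Data.Product using (_×_; _,_; ∃-syntax)
open import Data.Sum using ([_,_]′)
open import Relation.Nullary using (¬_; contradiction)
open import Relation.Nullary.Decidable using (from-yes)
open import Function.Bundles using (Equivalence)
open import Relation.Binary.PropositionalEquality using (_≡_; refl; sym; trans; cong; cong₂; subst; module ≡-Reasoning)

fromℚᵘ-homo-* : ∀ p q → fromℚᵘ p *ℚ fromℚᵘ q ≡ fromℚᵘ (p ℚᵘ.* q)
fromℚᵘ-homo-* p q = ℚP.toℚᵘ-injective (begin
  toℚᵘ (fromℚᵘ p *ℚ fromℚᵘ q)            ≈⟨ ℚP.toℚᵘ-homo-* (fromℚᵘ p) (fromℚᵘ q) ⟩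
  toℚᵘ (fromℚᵘ p) ℚᵘ.* toℚᵘ (fromℚᵘ q)  ≈⟨ ℚᵘP.*-cong (ℚP.toℚᵘ-fromℚᵘ p) (ℚP.toℚᵘ-fromℚᵘ q) ⟩
  p ℚᵘ.* q                               ≈⟨ ℚP.toℚᵘ-fromℚᵘ (p ℚᵘ.* q) ⟨
  toℚᵘ (fromℚᵘ (p ℚᵘ.* q))               ∎)
  where open ℚᵘP.≃-Reasoning

/-*-/≡/ : ∀ a b c d e f → a * c * suc f ≡ e * (suc b * suc d) →
          (+ a /ℚ suc b) *ℚ (+ c /ℚ suc d) ≡ + e /ℚ suc f
/-*-/≡/ a b c d e f eq =
  trans (fromℚᵘ-homo-* (mkℚᵘ (+ a) b) (mkℚᵘ (+ c) d))
        (ℚP.fromℚᵘ-cong {mkℚᵘ (+ a) b ℚᵘ.* mkℚᵘ (+ c) d} {mkℚᵘ (+ e) f} (*≡* cross))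
  where
  open ≡-Reasoning
  cross : + a ℤ.* + c ℤ.* + suc f ≡ + e ℤ.* + (suc b * suc d)
  cross = begin
    + a ℤ.* + c ℤ.* + suc f    ≡⟨ cong (ℤ._* + suc f) (ℤP.pos-* a c) ⟨
    + (a * c) ℤ.* + suc f      ≡⟨ ℤP.pos-* (a * c) (suc f) ⟨
    + (a * c * suc f)          ≡⟨ cong +_ eq ⟩
    + (e * (suc b * suc d))    ≡⟨ ℤP.pos-* e (suc b * suc d) ⟩
    + e ℤ.* + (suc b * suc d)  ∎

ℕ→ℚ-homo-* : ∀ m n → ℕ→ℚ (m * n) ≡ ℕ→ℚ m *ℚ ℕ→ℚ n
ℕ→ℚ-homo-* m n = sym (/-*-/≡/ m 0 n 0 (m * n) 0 refl)

g[n]*ginv[n]≡1 : ∀ n → g n *ℚ ginv n ≡ 1ℚ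
g[n]*ginv[n]≡1 n = /-*-/≡/ (3 * n + 2) (2 * n) (2 * n + 1) (3 * n + 1) 1 0 (solve (n ∷ []))

ginv[n]*[3n+2]≡2n+1 : ∀ n → ginv n *ℚ ℕ→ℚ (3 * n + 2) ≡ ℕ→ℚ (2 * n + 1)
ginv[n]*[3n+2]≡2n+1 n = /-*-/≡/ (2 * n + 1) (3 * n + 1) (3 * n + 2) 0 (2 * n + 1) 0 (solve (n ∷ []))

W⇒invertible-in-Winv : ∀ {q} → W q → ∃[ r ] Winv r × q *ℚ r ≡ 1ℚ
W⇒invertible-in-Winv (W-gen n) = ginv n , Winv-gen n , g[n]*ginv[n]≡1 n
W⇒invertible-in-Winv W-half    = + 2 /ℚ 1 , Winv-two , refl
W⇒invertible-in-Winv (W-mul {p} {q} wp wq) with W⇒invertible-in-Winv wp | W⇒invertible-in-Winv wq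
... | r , vr , pr≡1 | s , vs , qs≡1 = r *ℚ s , Winv-mul vr vs , (begin
  (p *ℚ q) *ℚ (r *ℚ s)  ≡⟨ interchange p q r s ⟩
  (p *ℚ r) *ℚ (q *ℚ s)  ≡⟨ cong₂ _*ℚ_ pr≡1 qs≡1 ⟩
  1ℚ                    ∎)
  where open ≡-Reasoning

-- A record rather than Winv ∘ ℕ→ℚ, so that unification can recover n.
record Winvℕ (n : ℕ) : Set where
  constructor winvℕ
  field winv : Winv (ℕ→ℚ n)

Winvℕ-* : ∀ {m n} → Winvℕ m → Winvℕ n → Winvℕ (m * n)
Winvℕ-* {m} {n} (winvℕ wm) (winvℕ wn) = winvℕ (subst Winv (sym (ℕ→ℚ-homo-* m n)) (Winv-mul wm wn))

Winvℕ-cancel-W : ∀ {m s} → W (ℕ→ℚ s) → Winvℕ (m * s) → Winvℕ m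
Winvℕ-cancel-W {m} {s} ws (winvℕ wms) with W⇒invertible-in-Winv ws
... | r , vr , sr≡1 = winvℕ (subst Winv ms*r≡m (Winv-mul wms vr))
  where
  open ≡-Reasoning
  ms*r≡m : ℕ→ℚ (m * s) *ℚ r ≡ ℕ→ℚ m
  ms*r≡m = begin
    ℕ→ℚ (m * s) *ℚ r           ≡⟨ cong (_*ℚ r) (ℕ→ℚ-homo-* m s) ⟩
    ℕ→ℚ m *ℚ ℕ→ℚ s *ℚ r        ≡⟨ ℚP.*-assoc (ℕ→ℚ m) (ℕ→ℚ s) r ⟩
    ℕ→ℚ m *ℚ (ℕ→ℚ s *ℚ r)      ≡⟨ cong (ℕ→ℚ m *ℚ_) sr≡1 ⟩
    ℕ→ℚ m *ℚ 1ℚ                ≡⟨ ℚP.*-identityʳ (ℕ→ℚ m) ⟩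
    ℕ→ℚ m                      ∎

Winvℕ-ginv : ∀ n → Winvℕ (3 * n + 2) → Winvℕ (2 * n + 1)
Winvℕ-ginv n (winvℕ w) = winvℕ (subst Winv (ginv[n]*[3n+2]≡2n+1 n) (Winv-mul (Winv-gen n) w))

Winvℕ-odd-step : ∀ {x y} → 3 * x + 1 ≡ 2 * y → Winvℕ y → Winvℕ x
Winvℕ-odd-step {x} {y} 3x+1≡2y wy with x divMod 2
... | result n 0F refl = contradiction 2∣1 (>⇒∤ ≤-refl)
  where
  2∣1 : 2 ∣ 1
  2∣1 = ∣m+n∣m⇒∣n (subst (2 ∣_) (sym 3x+1≡2y) (m∣m*n y)) (∣n⇒∣m*n 3 (n∣m*n n))
... | result n 1F refl = subst Winvℕ 2n+1≡x (Winvℕ-ginv n (subst Winvℕ y≡3n+2 wy))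
  where
  2n+1≡x : 2 * n + 1 ≡ 1 + n * 2
  2n+1≡x = solve (n ∷ [])
  y≡3n+2 : y ≡ 3 * n + 2
  y≡3n+2 = *-cancelˡ-≡ y (3 * n + 2) 2 (trans (sym 3x+1≡2y) (solve (n ∷ [])))

Winvℕ-2 : Winvℕ 2
Winvℕ-2 = winvℕ Winv-two

Winvℕ-1 : Winvℕ 1
Winvℕ-1 = Winvℕ-odd-step refl Winvℕ-2

Winvℕ-3 : Winvℕ 3
Winvℕ-3 = Winvℕ-odd-step {y = 5} refl (Winvℕ-odd-step refl (Winvℕ-* Winvℕ-2 (Winvℕ-* Winvℕ-2 Winvℕ-2)))

3∤3q+1 : ∀ q → ¬ 3 ∣ 3 * q + 1
3∤3q+1 q 3∣3q+1 = >⇒∤ (n≤1+n 2) (∣m+n∣m⇒∣n 3∣3q+1 (m∣m*n q))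

3∤3q+2 : ∀ q → ¬ 3 ∣ 3 * q + 2
3∤3q+2 q 3∣3q+2 = >⇒∤ ≤-refl (∣m+n∣m⇒∣n 3∣3q+2 (m∣m*n q))

3∤-* : ∀ {m n} → ¬ 3 ∣ m → ¬ 3 ∣ n → ¬ 3 ∣ m * n
3∤-* {m} {n} 3∤m 3∤n 3∣mn = [ 3∤m , 3∤n ]′ (euclidsLemma m n (from-yes (prime? 3)) 3∣mn)

3∤⇒W : WildNumbersConjecture → ∀ {n} → ¬ 3 ∣ n → W (ℕ→ℚ n)
3∤⇒W conj {zero}  3∤0 = contradiction (3 ∣0) 3∤0
3∤⇒W conj {suc n} 3∤n = Equivalence.from (conj (suc n)) (s≤s z≤n , 3∤n)

Winvℕ-cancel-3∤ : WildNumbersConjecture → ∀ {m s} → ¬ 3 ∣ s → Winvℕ (m * s) → Winvℕ m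
Winvℕ-cancel-3∤ conj 3∤s = Winvℕ-cancel-W (3∤⇒W conj 3∤s)

Winvℕ-3[a+6j] : ∀ a j → Winvℕ (a + 6 * j) → Winvℕ (3 * a + 18 * j)
Winvℕ-3[a+6j] a j w = subst Winvℕ 3[a+6j]≡3a+18j (Winvℕ-* Winvℕ-3 w)
  where
  3[a+6j]≡3a+18j : 3 * (a + 6 * j) ≡ 3 * a + 18 * j
  3[a+6j]≡3a+18j = trans (*-distribˡ-+ 3 a (6 * j)) (cong (_+_ (3 * a)) (sym (*-assoc 3 6 j)))

Winvℕ-from-square : WildNumbersConjecture → ∀ {N s u} → ¬ 3 ∣ s → Winvℕ u →
                    3 * (N * s) + 1 ≡ 4 * (u * u) → Winvℕ N
Winvℕ-from-square conj {u = u} 3∤s wu certificate =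
  Winvℕ-cancel-3∤ conj 3∤s
    (Winvℕ-odd-step (trans certificate (*-assoc 2 2 (u * u))) (Winvℕ-* Winvℕ-2 (Winvℕ-* wu wu)))

3[k[3k+2]]+1≡4u² : ∀ {k u} → 3 * k + 1 ≡ 2 * u → 3 * (k * (3 * k + 2)) + 1 ≡ 4 * (u * u)
3[k[3k+2]]+1≡4u² {k} {u} 3k+1≡2u = begin
  3 * (k * (3 * k + 2)) + 1   ≡⟨ solve (k ∷ []) ⟩
  (3 * k + 1) * (3 * k + 1)   ≡⟨ cong (λ v → v * v) 3k+1≡2u ⟩
  2 * u * (2 * u)             ≡⟨ solve (u ∷ []) ⟩
  4 * (u * u)                 ∎
  where open ≡-Reasoning

Winvℕ-from-3Na+1≡2u : WildNumbersConjecture → ∀ {N a u} → ¬ 3 ∣ a → Winvℕ u →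
                      3 * (N * a) + 1 ≡ 2 * u → Winvℕ N
Winvℕ-from-3Na+1≡2u conj {N} {a} {u} 3∤a wu 3Na+1≡2u = Winvℕ-from-square conj
  (3∤-* 3∤a (3∤3q+2 (N * a)))
  wu
  (trans (cong (λ x → 3 * x + 1) (sym (*-assoc N a (3 * (N * a) + 2))))
         (3[k[3k+2]]+1≡4u² {N * a} {u} 3Na+1≡2u))

-- u = (N − 2)((N + 1)/2)² has N ∣ 2u + 1 and u ≡ 8 (mod 9),
-- so both factors of s = ((2u + 1)/N)·((2u − 1)/3) are ≡ 2 (mod 3).
Winvℕ-7+18j : WildNumbersConjecture → ∀ j → Winvℕ (5 + 18 * j) → Winvℕ (4 + 9 * j) → Winvℕ (7 + 18 * j)
Winvℕ-7+18j conj j w₅ w₄ = Winvℕ-from-square conj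
  (3∤-* (3∤3q+2 (7 + 42 * j + 54 * j * j)) (3∤3q+2 (17 + 144 * j + 378 * j * j + 324 * j * j * j)))
  (Winvℕ-* (Winvℕ-* w₅ w₄) w₄)
  (solve (j ∷ []))

-- u = (N − 4)((N − 1)/2)³ has N ∣ 2u − 1 and u ≡ 2 (mod 9), so 2u − 1 = 3N·a with a ≡ 2 (mod 3).
Winvℕ-11+18j : WildNumbersConjecture → ∀ j → Winvℕ (7 + 18 * j) → Winvℕ (5 + 9 * j) → Winvℕ (11 + 18 * j)
Winvℕ-11+18j conj j w₇ w₅ = Winvℕ-from-3Na+1≡2u conj
  (3∤3q+2 (17 + 112 * j + 234 * j * j + 162 * j * j * j))
  (Winvℕ-* (Winvℕ-* (Winvℕ-* w₇ w₅) w₅) w₅)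
  (solve (j ∷ []))

WinvBelow : ℕ → Set
WinvBelow N = ∀ {m} → m < N → 1 ≤ m → Winvℕ m

WinvBelowAffine : ℕ → ℕ → ℕ → Set
WinvBelowAffine b d j = ∀ a c .{{_ : NonZero a}} {_ : T (a <ᵇ b)} {_ : T (c ≤ᵇ d)} → Winvℕ (a + c * j)

WinvBelow⇒WinvBelowAffine : ∀ b d j → WinvBelow (b + d * j) → WinvBelowAffine b d j
WinvBelow⇒WinvBelowAffine b d j below a c {a<b} {c≤d} =
  below (+-mono-<-≤ (<ᵇ⇒< a b a<b) (*-monoˡ-≤ j (≤ᵇ⇒≤ c d c≤d)))
        (≤-trans (>-nonZero⁻¹ a) (m≤m+n a (c * j)))

Winvℕ-3+2r+18j : WildNumbersConjecture → ∀ (r : Fin 9) j →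
                 WinvBelowAffine (3 + 2 * toℕ r) 18 j → Winvℕ (3 + 2 * toℕ r + 18 * j)
Winvℕ-3+2r+18j conj 0F j smaller = Winvℕ-3[a+6j] 1 j (smaller 1 6)
Winvℕ-3+2r+18j conj 1F j smaller = Winvℕ-from-square conj (3∤3q+1 (2 * j)) (smaller 2 9) (solve (j ∷ []))
Winvℕ-3+2r+18j conj 2F j smaller = Winvℕ-7+18j conj j (smaller 5 18) (smaller 4 9)
Winvℕ-3+2r+18j conj 3F j smaller = Winvℕ-3[a+6j] 3 j (smaller 3 6)
Winvℕ-3+2r+18j conj 4F j smaller = Winvℕ-11+18j conj j (smaller 7 18) (smaller 5 9)
Winvℕ-3+2r+18j conj 5F j smaller = Winvℕ-from-square conj (3∤3q+2 (1 + 2 * j)) (smaller 7 9) (solve (j ∷ []))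
Winvℕ-3+2r+18j conj 6F j smaller = Winvℕ-3[a+6j] 5 j (smaller 5 6)
Winvℕ-3+2r+18j conj 7F j smaller = Winvℕ-from-square conj (3∤3q+2 (1 + 2 * j)) (smaller 8 9) (solve (j ∷ []))
Winvℕ-3+2r+18j conj 8F j smaller = Winvℕ-from-square conj (3∤3q+1 (2 + 2 * j)) (smaller 10 9) (solve (j ∷ []))

Winvℕ-3+2n : WildNumbersConjecture → ∀ n → WinvBelow (3 + n * 2) → Winvℕ (3 + n * 2)
Winvℕ-3+2n conj n below with n divMod 9
... | result j r refl = subst Winvℕ (sym (regroup (toℕ r) j)) (Winvℕ-3+2r+18j conj r j smaller)
  where
  regroup : ∀ x y → 3 + (x + y * 9) * 2 ≡ 3 + 2 * x + 18 * y
  regroup = solve-∀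
  smaller : WinvBelowAffine (3 + 2 * toℕ r) 18 j
  smaller = WinvBelow⇒WinvBelowAffine (3 + 2 * toℕ r) 18 j (subst WinvBelow (regroup (toℕ r) j) below)

Winvℕ-positive : WildNumbersConjecture → ∀ N → 1 ≤ N → Winvℕ N
Winvℕ-positive conj = <-rec (λ N → 1 ≤ N → Winvℕ N) step
  where
  step : ∀ N → WinvBelow N → 1 ≤ N → Winvℕ N
  step N below 1≤N with N divMod 2
  ... | result zero      0F refl = contradiction 1≤N λ ()
  ... | result M@(suc _) 0F refl = Winvℕ-* (below (m<m*n M 2 ≤-refl) (s≤s z≤n)) Winvℕ-2
  ... | result zero      1F refl = Winvℕ-1
  ... | result (suc n)   1F refl = Winvℕ-3+2n conj n below

theorem3p4 : WildNumbersConjecture → Weak3x+1Conjecture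
theorem3p4 conj n 1≤n = Winvℕ.winv (Winvℕ-positive conj n 1≤n)
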